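{- (i) If $G$ is a triod with $\ell_3(G)\ge 2\rho+2$ for an integer $\rho\ge 0$, then in the patrol game with radius of capture $\rho$ on $G$ the robber has a strategy that avoids capture against every patrol of the cop (i.e., $\rho(G)>\rho$). (ii) If $G$ is a clique-triod with $\ell_3(G)\ge 2\rho+1$ for an integer $\rho\ge 0$, then in the patrol game with radius of capture $\rho$ on $G$ the robber has a strategy that avoids capture against every patrol of the cop (i.e., $\rho(G)>\rho$).
   Context: Patrol game with radius of capture $\rho\ge 0$ on a connected graph $G$: there is one cop and one robber. Before the game the cop fixes a walk in $G$ (his patrol: a sequence of vertices in which consecutive vertices are equal or adjacent), and the robber knows the entire patrol in advance, while the cop has no information about the robber. The cop starts at the first vertex of his patrol, then the robber chooses a starting vertex; afterwards the players alternate moves (cop first), the cop following his patrol and the robber moving to an adjacent vertex or staying put. The cop wins if at some moment the distance between the cop and the robber is at most $\rho$; otherwise the robber wins. $\rho(G)$ is the minimum $\rho\ge0$ for which the cop has a patrol capturing the robber regardless of the robber's play. A triod is a tree with exactly three leaves and a unique vertex of degree three, its origin; for a triod $T$, $\ell_3(T)$ is the distance from the origin to the closest of the three leaves. A clique-triod is a graph obtained from a clique on at least $3$ vertices (the clique-origin) and three vertex-disjoint paths, each attached by one endpoint to a different vertex of the clique-origin (and otherwise disjoint from it); for a clique-triod $G$, $\ell_3(G)$ is the length (number of edges) of the shortest of the three paths. -}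

module Defs where

open import Data.Nat using (ℕ; zero; suc; _≤_; _<_; _+_; _*_; _⊓_)
open import Data.Fin using (Fin; inject₁) renaming (zero to fzero; suc to fsuc)
open import Data.Product using (Σ; _×_; ∃; ∃-syntax)
open import Data.Sum using (_⊎_)
open import Relation.Binary.PropositionalEquality using (_≡_)
open import Relation.Nullary using (¬_)
open import Function.Definitions using (Injective)

-- Graphs (simple, undirected: Adj is required to be symmetric and
-- irreflexive by the concrete constructions below)

record Graph : Set₁ where
  field
    V   : Set
    Adj : V → V → Set

module _ (G : Graph) where
  open Graph G

  -- Reach k u v : there is a walk with at most k edges from u to v,
  -- i.e. dist(u , v) ≤ k.
  data Reach : ℕ → V → V → Set where
    here : ∀ {k u} → Reach k u u
    step : ∀ {k u w v} → Adj u w → Reach k w v → Reach (suc k) u v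

  LazyAdj : V → V → Set
  LazyAdj u v = u ≡ v ⊎ Adj u v

  record Walk (n : ℕ) : Set where
    field
      pos   : Fin (suc n) → V
      moves : (i : Fin n) → LazyAdj (pos (inject₁ i)) (pos (fsuc i))
  open Walk public

  -- Patrol game with radius of capture ρ, against the patrol p.
  -- Time i: cop at p_i, robber at r_i.  The cop starts at p_0, the
  -- robber then picks r_0; then cop moves p_i → p_{i+1}, robber moves
  -- r_i → r_{i+1}.  Robber must avoid distance ≤ ρ at every moment:
  -- after his own choices (dist(p_i , r_i) > ρ) and after each cop move
  -- (dist(p_{i+1} , r_i) > ρ).  Since the robber knows the whole patrol,
  -- his strategy against p is a walk r of the same duration.
  Evades : ℕ → {n : ℕ} → Walk n → Walk n → Set
  Evades ρ {n} p r =
    ((i : Fin (suc n)) → ¬ Reach ρ (pos p i) (pos r i)) ×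
    ((i : Fin n) → ¬ Reach ρ (pos p (fsuc i)) (pos r (inject₁ i)))

  RobberWins : ℕ → Set
  RobberWins ρ = ∀ {n} (p : Walk n) → ∃[ r ] Evades ρ p r

-- Triods: a tree with three leaves and a unique degree-3 vertex, i.e.
-- an origin with three internally disjoint legs of lengths a, b, c ≥ 1.

len3 : ℕ → ℕ → ℕ → Fin 3 → ℕ
len3 a b c fzero = a
len3 a b c (fsuc fzero) = b
len3 a b c (fsuc (fsuc fzero)) = c

-- leg i j _ is the vertex on leg i at distance j+1 from the origin
data TV (a b c : ℕ) : Set where
  origin : TV a b c
  leg    : (i : Fin 3) (j : ℕ) → j < len3 a b c i → TV a b c

data TE {a b c : ℕ} : TV a b c → TV a b c → Set where
  root : ∀ {i} (p : 0 < len3 a b c i) → TE origin (leg i 0 p)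
  next : ∀ {i j} (p : j < len3 a b c i) (q : suc j < len3 a b c i) →
         TE (leg i j p) (leg i (suc j) q)

Triod : (a b c : ℕ) → Graph
Triod a b c = record
  { V = TV a b c
  ; Adj = λ u v → TE u v ⊎ TE v u }

ℓ₃-triod : ℕ → ℕ → ℕ → ℕ
ℓ₃-triod a b c = (a ⊓ b) ⊓ c

-- Clique-triods: a clique on k ≥ 3 vertices with three vertex-disjoint
-- paths of lengths a, b, c, path i having one endpoint equal to the
-- clique vertex att i (att injective) and otherwise disjoint from the
-- clique.

-- pth i j _ is the vertex of path i at distance j+1 from att i
data CV (k a b c : ℕ) : Set where
  cl  : Fin k → CV k a b c
  pth : (i : Fin 3) (j : ℕ) → j < len3 a b c i → CV k a b c

data CE {k a b c : ℕ} (att : Fin 3 → Fin k) : CV k a b c → CV k a b c → Set where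
  clique : ∀ {u v} → ¬ u ≡ v → CE att (cl u) (cl v)
  root   : ∀ {i} (p : 0 < len3 a b c i) → CE att (cl (att i)) (pth i 0 p)
  next   : ∀ {i j} (p : j < len3 a b c i) (q : suc j < len3 a b c i) →
           CE att (pth i j p) (pth i (suc j) q)

CliqueTriod : (k a b c : ℕ) → (Fin 3 → Fin k) → Graph
CliqueTriod k a b c att = record
  { V = CV k a b c
  ; Adj = λ u v → CE att u v ⊎ CE att v u }

ℓ₃-clique : ℕ → ℕ → ℕ → ℕ
ℓ₃-clique a b c = (a ⊓ b) ⊓ c

{-# OPTIONS --safe #-}
-- The robber uses one route into each leg.  At depth L of leg x he cannot be caught by a
-- cop who is not deep in x (potential depth x); at depth f < L he cannot be caught by a cop
-- who was deep in another leg at most f steps earlier or later (potential refugeDist x).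
-- So he sits in a leg x; when the cop will next go deep into x, at time T, the robber walks
-- back so as to reach the hub just after the last time σ < T at which the cop is deep in
-- another leg j, and escapes into the third leg y.  From σ on the cop has to be deep in x
-- (at T) before he can be deep in y, so the same manoeuvre can be repeated.  Triods with
-- ℓ₃ ≥ 2ρ + 2 and clique-triods with ℓ₃ ≥ 2ρ + 1 carry such potentials, with L = 2ρ + 2
-- and L = 2ρ + 1 respectively.
module Submission where

open import Defs
open import Data.Nat using (ℕ; _≤_; _+_; _*_)
open import Data.Fin using (Fin)
open import Data.Product using (_×_)
open import Function.Definitions using (Injective)
open import Relation.Binary.PropositionalEquality using (_≡_)

open import Data.Nat using (zero; suc; _<_; _∸_; _⊓_; z≤n; s≤s; _≤?_; _<?_)
open import Data.Nat.Properties
open import Data.Nat.Tactic.RingSolver using (solve-∀)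
open import Data.Fin using (toℕ; inject₁; fromℕ; fromℕ<) renaming (zero to fzero; suc to fsuc)
open import Data.Fin.Properties using (toℕ-inject₁; toℕ-fromℕ<; any?) renaming (_≟_ to _≟ᶠ_)
open import Data.Product using (Σ-syntax; ∃-syntax; _,_; proj₁; proj₂)
open import Data.Sum using (_⊎_; inj₁; inj₂; swap)
open import Data.Empty using (⊥-elim)
open import Relation.Nullary using (¬_; yes; no)
open import Relation.Nullary.Decidable using (_×-dec_; ¬?)
open import Relation.Unary using (Decidable)
open import Relation.Binary.Definitions using (tri<; tri≈; tri>)
open import Relation.Binary.PropositionalEquality using (_≢_; refl; sym; trans; cong; subst; subst₂)

Lipschitz : (G : Graph) → (Graph.V G → ℕ) → Set
Lipschitz G φ = ∀ {u w} → Graph.Adj G u w → φ w ≤ suc (φ u)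

module _ {G : Graph} where
  open Graph G

  reach-weaken : ∀ {k m u v} → k ≤ m → Reach G k u v → Reach G m u v
  reach-weaken _         here         = here
  reach-weaken (s≤s k≤m) (step uw wv) = step uw (reach-weaken k≤m wv)

  reach-trans : ∀ {k m u w v} → Reach G k u w → Reach G m w v → Reach G (k + m) u v
  reach-trans {k} here         wv = reach-weaken (m≤n+m _ k) wv
  reach-trans     (step ux xw) wv = step ux (reach-trans xw wv)

  lazy⇒reach : ∀ {u v} → LazyAdj G u v → Reach G 1 u v
  lazy⇒reach (inj₁ refl) = here
  lazy⇒reach (inj₂ uv)   = step uv here

  reach-lipschitz : ∀ {φ} → Lipschitz G φ → ∀ {k u v} → Reach G k u v → φ v ≤ k + φ u
  reach-lipschitz {φ} lip {k} {u} here = m≤n+m (φ u) k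
  reach-lipschitz {φ} lip (step {k} {u} {w} {v} uw wv) = begin
    φ v           ≤⟨ reach-lipschitz lip wv ⟩
    k + φ w       ≤⟨ +-monoʳ-≤ k (lip uw) ⟩
    k + suc (φ u) ≡⟨ +-suc k (φ u) ⟩
    suc k + φ u   ∎
    where open ≤-Reasoning

  module _ (Adj-sym : ∀ {u v} → Adj u v → Adj v u) where
    reach-sym : ∀ {k u v} → Reach G k u v → Reach G k v u
    reach-sym here              = here
    reach-sym (step {k} {u} {w} {v} uw wv) =
      subst (λ m → Reach G m v u) (+-comm k 1) (reach-trans (reach-sym wv) (step (Adj-sym uw) here))

    lazy-sym : ∀ {u v} → LazyAdj G u v → LazyAdj G v u
    lazy-sym (inj₁ refl) = inj₁ refl
    lazy-sym (inj₂ uv)   = inj₂ (Adj-sym uv)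

Near : ℕ → ℕ → Set
Near m n = m ≤ suc n × n ≤ suc m

near-refl : ∀ n → Near n n
near-refl n = n≤1+n n , n≤1+n n

near-suc : ∀ n → Near n (suc n)
near-suc n = m≤n+m n 2 , ≤-refl

near-sym : ∀ {m n} → Near m n → Near n m
near-sym (m≤1+n , n≤1+m) = n≤1+m , m≤1+n

near-⊓ : ∀ {a a′ b b′} → Near a a′ → Near b b′ → Near (a ⊓ b) (a′ ⊓ b′)
near-⊓ (a≤ , a′≤) (b≤ , b′≤) = ⊓-mono-≤ a≤ b≤ , ⊓-mono-≤ a′≤ b′≤

near-∸-suc : ∀ m n → Near (m ∸ n) (m ∸ suc n)
near-∸-suc zero    zero    = near-refl 0
near-∸-suc zero    (suc n) = near-refl 0
near-∸-suc (suc m) zero    = near-sym (near-suc m)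
near-∸-suc (suc m) (suc n) = near-∸-suc m n

near-elapsed : ∀ B {s t} → s ≤ t → Near (B + (t ∸ s)) (B + (suc t ∸ s))
near-elapsed B {s} {t} s≤t rewrite +-∸-assoc 1 s≤t | +-suc B (t ∸ s) = near-suc (B + (t ∸ s))

near-cases : ∀ {m n} → Near m n → m ≡ n ⊎ n ≡ suc m ⊎ m ≡ suc n
near-cases {m} {n} (m≤1+n , n≤1+m) with <-cmp m n
... | tri< m<n _ _ = inj₂ (inj₁ (≤-antisym n≤1+m m<n))
... | tri≈ _ m≡n _ = inj₁ m≡n
... | tri> _ _ n<m = inj₂ (inj₂ (≤-antisym m≤1+n n<m))

near-edges⇒lipschitz : ∀ {V : Set} {E : V → V → Set} {φ : V → ℕ} →
                       (∀ {u w} → E u w → Near (φ u) (φ w)) →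
                       ∀ {u w} → E u w ⊎ E w u → φ w ≤ suc (φ u)
near-edges⇒lipschitz near (inj₁ uw) = proj₂ (near uw)
near-edges⇒lipschitz near (inj₂ wu) = proj₁ (near wu)

earliest : ∀ {P : ℕ → Set} → Decidable P → ∀ N →
           (∀ t → t < N → ¬ P t) ⊎ (Σ[ T ∈ ℕ ] P T × (∀ t → t < T → ¬ P t))
earliest P? zero = inj₁ (λ _ ())
earliest {P} P? (suc N) with earliest P? N
... | inj₂ found = inj₂ found
... | inj₁ none with P? N
...   | yes PN  = inj₂ (N , PN , none)
...   | no  ¬PN = inj₁ none′
  where
  none′ : ∀ t → t < suc N → ¬ P t
  none′ t t<1+N with m≤n⇒m<n∨m≡n (≤-pred t<1+N)
  ... | inj₁ t<N  = none t t<N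
  ... | inj₂ refl = ¬PN

latest : ∀ {P : ℕ → Set} → Decidable P → ∀ {u} T → u < T → P u →
         Σ[ σ ∈ ℕ ] u ≤ σ × σ < T × P σ × (∀ v → σ < v → v < T → ¬ P v)
latest P? (suc T) u<1+T Pu with P? T
... | yes PT = T , ≤-pred u<1+T , ≤-refl , PT ,
               λ v T<v v<1+T → ⊥-elim (<⇒≱ T<v (≤-pred v<1+T))
... | no ¬PT with m≤n⇒m<n∨m≡n (≤-pred u<1+T)
...   | inj₂ refl = ⊥-elim (¬PT Pu)
...   | inj₁ u<T with latest P? T u<T Pu
...     | σ , u≤σ , σ<T , Pσ , after = σ , u≤σ , m≤n⇒m≤1+n σ<T , Pσ , after′
  where
  after′ : ∀ v → σ < v → v < suc T → ¬ _
  after′ v σ<v v<1+T with m≤n⇒m<n∨m≡n (≤-pred v<1+T)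
  ... | inj₁ v<T  = after v σ<v v<T
  ... | inj₂ refl = ¬PT

-- Walks as sequences indexed by all times

clamp : ℕ → (n : ℕ) → Fin (suc n)
clamp zero    n       = fzero
clamp (suc t) zero    = fzero
clamp (suc t) (suc n) = fsuc (clamp t n)

clamp-toℕ : ∀ n (i : Fin (suc n)) → clamp (toℕ i) n ≡ i
clamp-toℕ n       fzero    = refl
clamp-toℕ zero    (fsuc ())
clamp-toℕ (suc n) (fsuc i) = cong fsuc (clamp-toℕ n i)

clamp-at : ∀ {t n} (i : Fin (suc n)) → toℕ i ≡ t → clamp t n ≡ i
clamp-at i refl = clamp-toℕ _ i

clamp-≥ : ∀ {t n} → n ≤ t → clamp t n ≡ fromℕ n
clamp-≥ {zero}  z≤n       = refl
clamp-≥ {suc t} z≤n       = refl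
clamp-≥ {suc t} (s≤s n≤t) = cong fsuc (clamp-≥ n≤t)

module _ {G : Graph} {n : ℕ} (p : Walk G n) where
  position : ℕ → Graph.V G
  position t = pos p (clamp t n)

  position-toℕ : ∀ i → position (toℕ i) ≡ pos p i
  position-toℕ i = cong (pos p) (clamp-toℕ n i)

  position-frozen : ∀ {t} → n ≤ t → position t ≡ position n
  position-frozen n≤t = cong (pos p) (trans (clamp-≥ n≤t) (sym (clamp-≥ ≤-refl)))

  position-lazy : ∀ t → LazyAdj G (position t) (position (suc t))
  position-lazy t with t <? n
  ... | yes t<n = subst₂ (LazyAdj G)
                    (cong (pos p) (sym (clamp-at (inject₁ i) (trans (toℕ-inject₁ i) (toℕ-fromℕ< t<n)))))
                    (cong (pos p) (sym (clamp-at (fsuc i) (cong suc (toℕ-fromℕ< t<n)))))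
                    (moves p i)
    where i = fromℕ< t<n
  ... | no t≮n = inj₁ (trans (position-frozen (≮⇒≥ t≮n))
                             (sym (position-frozen (m≤n⇒m≤1+n (≮⇒≥ t≮n)))))

  position-reach : ∀ d s → Reach G d (position s) (position (d + s))
  position-reach zero    s = here
  position-reach (suc d) s =
    subst (λ t → Reach G (suc d) (position s) (position t)) (+-suc d s)
          (reach-trans (lazy⇒reach (position-lazy s)) (position-reach d (suc s)))

splice : {A : Set} → ℕ → (ℕ → A) → (ℕ → A) → ℕ → A
splice σ f g t with t <? σ
... | yes _ = f t
... | no  _ = g t

module _ {G : Graph} where
  open Graph G

  trace : ∀ n (r : ℕ → V) → (∀ t → LazyAdj G (r t) (r (suc t))) → Walk G n
  trace n r lazy = record
    { pos   = λ i → r (toℕ i)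
    ; moves = λ i → subst (λ m → LazyAdj G (r m) (r (suc (toℕ i)))) (sym (toℕ-inject₁ i))
                          (lazy (toℕ i))
    }

-- Escaping along three long legs

third : (x j : Fin 3) → Σ[ y ∈ Fin 3 ] y ≢ x × y ≢ j
third fzero               fzero               = fsuc fzero , (λ ()) , (λ ())
third fzero               (fsuc fzero)        = fsuc (fsuc fzero) , (λ ()) , (λ ())
third fzero               (fsuc (fsuc fzero)) = fsuc fzero , (λ ()) , (λ ())
third (fsuc fzero)        fzero               = fsuc (fsuc fzero) , (λ ()) , (λ ())
third (fsuc fzero)        (fsuc fzero)        = fzero , (λ ()) , (λ ())
third (fsuc fzero)        (fsuc (fsuc fzero)) = fzero , (λ ()) , (λ ())
third (fsuc (fsuc fzero)) fzero               = fsuc fzero , (λ ()) , (λ ())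
third (fsuc (fsuc fzero)) (fsuc fzero)        = fzero , (λ ()) , (λ ())
third (fsuc (fsuc fzero)) (fsuc (fsuc fzero)) = fzero , (λ ()) , (λ ())

-- route x f is the robber's spot at depth f (capped at L) in leg x, route x 0 being where
-- leg x leaves the hub; a vertex v is deep in leg i when L ≤ ρ + depth i v.  refugeDist x
-- measures the distance to the refuge route x L.
record ThreeLegs (G : Graph) (ρ : ℕ) : Set where
  open Graph G
  field
    Adj-sym              : ∀ {u v} → Adj u v → Adj v u
    L                    : ℕ
    route                : Fin 3 → ℕ → V
    route-up             : ∀ x f → LazyAdj G (route x f) (route x (suc f))
    route-switch         : ∀ {x y} → x ≢ y → LazyAdj G (route x 0) (route y 0)
    depth                : Fin 3 → V → ℕ
    depth-lipschitz      : ∀ x → Lipschitz G (depth x)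
    depth-route          : ∀ x f → L ≤ f → L ≤ depth x (route x f)
    deep-unique          : ∀ {v i j} → L ≤ ρ + depth i v → L ≤ ρ + depth j v → i ≡ j
    refugeDist           : Fin 3 → V → ℕ
    refugeDist-lipschitz : ∀ x → Lipschitz G (refugeDist x)
    refugeDist-route     : ∀ x f → f < L → f + refugeDist x (route x f) ≤ L
    refugeDist-deep      : ∀ {w i x} → L ≤ ρ + depth i w → i ≢ x → suc (suc ρ) + L ≤ refugeDist x w

module RobberEscape {G : Graph} {ρ : ℕ} (legs : ThreeLegs G ρ) where
  open Graph G
  open ThreeLegs legs

  Deep : Fin 3 → V → Set
  Deep x v = L ≤ ρ + depth x v

  deep? : ∀ x → Decidable (Deep x)
  deep? x v = L ≤? ρ + depth x v

  route-near : ∀ x {e e′} → Near e e′ → LazyAdj G (route x e) (route x e′)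
  route-near x {e} {e′} near with near-cases near
  ... | inj₁ refl        = inj₁ refl
  ... | inj₂ (inj₁ refl) = route-up x e
  ... | inj₂ (inj₂ refl) = lazy-sym {G = G} Adj-sym (route-up x e′)

  far-from-shallow : ∀ {q x f} → L ≤ f → ¬ Deep x q → ¬ Reach G ρ q (route x f)
  far-from-shallow {q} {x} {f} L≤f shallow q~r =
    shallow (≤-trans (depth-route x f L≤f) (reach-lipschitz (depth-lipschitz x) q~r))

  far-from-elsewhere : ∀ {w q x i f} → f < L → Deep i w → i ≢ x →
                       Reach G (suc f) w q → ¬ Reach G ρ q (route x f)
  far-from-elsewhere {w} {q} {x} {i} {f} f<L deep i≢x w~q q~r = 1+n≰n (begin
    suc (suc ρ) + L                        ≤⟨ refugeDist-deep deep i≢x ⟩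
    refugeDist x w                         ≤⟨ reach-lipschitz (refugeDist-lipschitz x)
                                                (reach-sym Adj-sym (reach-trans w~q q~r)) ⟩
    suc f + ρ + R                          ≡⟨ cong suc (trans (cong (_+ R) (+-comm f ρ)) (+-assoc ρ f R)) ⟩
    suc ρ + (f + R)                        ≤⟨ +-monoʳ-≤ (suc ρ) (refugeDist-route x f f<L) ⟩
    suc ρ + L                              ∎)
    where
    open ≤-Reasoning
    R = refugeDist x (route x f)

  module Pursuit {n : ℕ} (p : Walk G n) where
    cop : ℕ → V
    cop = position p

    cop-forward : ∀ {s t} → s ≤ t → Reach G (t ∸ s) (cop s) (cop t)
    cop-forward {s} {t} s≤t =
      subst (λ u → Reach G (t ∸ s) (cop s) (cop u)) (m∸n+n≡m s≤t) (position-reach p (t ∸ s) s)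

    cop-reach : ∀ {s t k} → s ≤ t + k → t ≤ s + k → Reach G k (cop s) (cop t)
    cop-reach {s} {t} s≤t+k t≤s+k with s ≤? t
    ... | yes s≤t = reach-weaken (m≤n+o⇒m∸n≤o t s t≤s+k) (cop-forward s≤t)
    ... | no  s≰t =
      reach-sym Adj-sym (reach-weaken (m≤n+o⇒m∸n≤o s t s≤t+k) (cop-forward (<⇒≤ (≰⇒> s≰t))))

    CopDeep : Fin 3 → ℕ → Set
    CopDeep x t = Deep x (cop t)

    DeepElsewhere : Fin 3 → ℕ → Set
    DeepElsewhere x t = Σ[ j ∈ Fin 3 ] j ≢ x × CopDeep j t

    deepElsewhere? : ∀ x → Decidable (DeepElsewhere x)
    deepElsewhere? x t = any? (λ j → ¬? (j ≟ᶠ x) ×-dec deep? j (cop t))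

    first-after : ∀ {P : V → Set} → Decidable P → ∀ s →
                  (∀ t → s ≤ t → ¬ P (cop t)) ⊎
                  (Σ[ T ∈ ℕ ] s ≤ T × P (cop T) × (∀ t → s ≤ t → t < T → ¬ P (cop t)))
    first-after {P} P? s with earliest (λ t → (s ≤? t) ×-dec P? (cop t)) (suc (s + n))
    ... | inj₂ (T , (s≤T , PT) , before) =
      inj₂ (T , s≤T , PT , λ t s≤t t<T Pt → before t t<T (s≤t , Pt))
    ... | inj₁ none = inj₁ never
      where
      never : ∀ t → s ≤ t → ¬ P (cop t)
      never t s≤t Pt with t ≤? s + n
      ... | yes t≤s+n = none t (s≤s t≤s+n) (s≤t , Pt)
      ... | no  t≰s+n = none (s + n) ≤-refl (m≤m+n s n , subst P frozen Pt)
        where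
        frozen : cop t ≡ cop (s + n)
        frozen = trans (position-frozen p (≤-trans (m≤n+m n s) (<⇒≤ (≰⇒> t≰s+n))))
                       (sym (position-frozen p (m≤n+m n s)))

    -- Time t covers both the robber's move at t and the cop's move to t + 1.
    SafeAt : ℕ → V → Set
    SafeAt t v = ¬ Reach G ρ (cop t) v × ¬ Reach G ρ (cop (suc t)) v

    -- Witnessed by a time s at which the cop was deep in another leg, too recent (or too
    -- imminent) for him to come within ρ of depth f of leg x at time t or t + 1.
    Covered : Fin 3 → ℕ → ℕ → Set
    Covered x f t = f < L → Σ[ s ∈ ℕ ] DeepElsewhere x s × s ≤ t + suc f × t ≤ s + f

    route-safe : ∀ {x f t} → ¬ CopDeep x t → ¬ CopDeep x (suc t) → Covered x f t → SafeAt t (route x f)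
    route-safe {x} {f} {t} shallow shallow′ covered =
      safe-from shallow ≤-refl (n≤1+n t) , safe-from shallow′ (n≤1+n t) ≤-refl
      where
      safe-from : ∀ {t′} → ¬ CopDeep x t′ → t ≤ t′ → t′ ≤ suc t → ¬ Reach G ρ (cop t′) (route x f)
      safe-from {t′} shallow t≤t′ t′≤1+t with f <? L
      ... | no f≮L = far-from-shallow (≮⇒≥ f≮L) shallow
      ... | yes f<L with covered f<L
      ...   | s , (j , j≢x , deep) , s≤ , t≤ =
        far-from-elsewhere f<L deep j≢x
          (cop-reach (≤-trans s≤ (+-monoˡ-≤ (suc f) t≤t′))
                     (≤-trans t′≤1+t (≤-trans (s≤s t≤) (≤-reflexive (sym (+-suc s f))))))

    SafeStart : ℕ → Fin 3 → ℕ → Set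
    SafeStart s x B = B < L → DeepElsewhere x s

    refuge-safeStart : ∀ s {x} → SafeStart s x L
    refuge-safeStart _ L<L = ⊥-elim (<-irrefl refl L<L)

    covered-since : ∀ {s x B t} → SafeStart s x B → s ≤ t → Covered x (B + (t ∸ s)) t
    covered-since {s} {x} {B} {t} started s≤t f<L =
      s , started (≤-<-trans (m≤m+n B (t ∸ s)) f<L) , ≤-trans s≤t (m≤m+n t _) , (begin
        t                 ≡⟨ m+[n∸m]≡n s≤t ⟨
        s + (t ∸ s)       ≤⟨ +-monoʳ-≤ s (m≤n+m (t ∸ s) B) ⟩
        s + (B + (t ∸ s)) ∎)
      where open ≤-Reasoning

    covered-until : ∀ {σ x t} → t < σ → DeepElsewhere x σ → Covered x (σ ∸ suc t) t
    covered-until {σ} {x} {t} t<σ elsewhere _ =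
      σ , elsewhere , ≤-reflexive (sym (trans (+-suc t _) (m+[n∸m]≡n t<σ))) ,
      ≤-trans (<⇒≤ t<σ) (m≤m+n σ _)

    covered-⊓ : ∀ {x f g t} → Covered x f t → Covered x g t → Covered x (f ⊓ g) t
    covered-⊓ {x} {f} {g} {t} covered-f covered-g with ⊓-sel f g
    ... | inj₁ f⊓g≡f = subst (λ h → Covered x h t) (sym f⊓g≡f) covered-f
    ... | inj₂ f⊓g≡g = subst (λ h → Covered x h t) (sym f⊓g≡g) covered-g

    EvadesFrom : ℕ → (ℕ → V) → Set
    EvadesFrom s r = (∀ t → s ≤ t → LazyAdj G (r t) (r (suc t)))
                   × (∀ t → s ≤ t → SafeAt t (r t))

    Escape : ℕ → Fin 3 → Set
    Escape σ y = Σ[ r ∈ (ℕ → V) ] r σ ≡ route y 0 × EvadesFrom σ r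

    settle : ∀ {s x B} → SafeStart s x B → (∀ t → s ≤ t → ¬ CopDeep x t) →
             EvadesFrom s (λ t → route x (B + (t ∸ s)))
    settle {s} {x} {B} started clear =
        (λ t s≤t → route-near x (near-elapsed B s≤t))
      , (λ t s≤t → route-safe (clear t s≤t) (clear (suc t) (m≤n⇒m≤1+n s≤t))
                              (covered-since started s≤t))

    -- The robber walks out of leg x from depth B at time s and is back at the hub at time
    -- σ − 1, just in time to step into leg y.
    retreat : ∀ {s σ x y B} → x ≢ y → SafeStart s x B → DeepElsewhere x σ →
              (∀ t → s ≤ t → t ≤ σ → ¬ CopDeep x t) → Escape σ y →
              Σ[ r ∈ (ℕ → V) ] EvadesFrom s r × (s < σ → r s ≡ route x (B ⊓ (σ ∸ suc s)))
    retreat {s} {σ} {x} {y} {B} x≢y started elsewhere clear (r′ , r′σ , lazy′ , safe′) =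
      r , (lazy , safe) , r-start
      where
      depthAt : ℕ → ℕ
      depthAt t = (B + (t ∸ s)) ⊓ (σ ∸ suc t)

      r : ℕ → V
      r = splice σ (λ t → route x (depthAt t)) r′

      lazy : ∀ t → s ≤ t → LazyAdj G (r t) (r (suc t))
      lazy t s≤t with t <? σ | suc t <? σ
      ... | yes _   | yes _     = route-near x (near-⊓ (near-elapsed B s≤t) (near-∸-suc σ (suc t)))
      ... | yes t<σ | no 1+t≮σ  =
        subst₂ (LazyAdj G) (cong (route x) (sym at-hub)) (sym (trans (cong r′ 1+t≡σ) r′σ)) (route-switch x≢y)
        where
        1+t≡σ : suc t ≡ σ
        1+t≡σ = ≤-antisym t<σ (≮⇒≥ 1+t≮σ)
        at-hub : depthAt t ≡ 0
        at-hub = trans (cong (λ m → (B + (t ∸ s)) ⊓ (m ∸ suc t)) (sym 1+t≡σ))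
                       (trans (cong ((B + (t ∸ s)) ⊓_) (n∸n≡0 t)) (⊓-zeroʳ _))
      ... | no t≮σ  | yes 1+t<σ = ⊥-elim (t≮σ (<-trans (n<1+n t) 1+t<σ))
      ... | no t≮σ  | no _      = lazy′ t (≮⇒≥ t≮σ)

      safe : ∀ t → s ≤ t → SafeAt t (r t)
      safe t s≤t with t <? σ
      ... | yes t<σ = route-safe (clear t s≤t (<⇒≤ t<σ)) (clear (suc t) (m≤n⇒m≤1+n s≤t) t<σ)
                        (covered-⊓ (covered-since started s≤t) (covered-until t<σ elsewhere))
      ... | no t≮σ = safe′ t (≮⇒≥ t≮σ)

      r-start : s < σ → r s ≡ route x (B ⊓ (σ ∸ suc s))
      r-start s<σ with s <? σ
      ... | yes _  =
        cong (λ e → route x (e ⊓ (σ ∸ suc s))) (trans (cong (B +_) (n∸n≡0 s)) (+-identityʳ B))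
      ... | no s≮σ = ⊥-elim (s≮σ s<σ)

    Forewarned : ℕ → Fin 3 → Set
    Forewarned a x = ∀ u → a ≤ u → CopDeep x u → Σ[ u′ ∈ ℕ ] a ≤ u′ × u′ < u × DeepElsewhere x u′

    record Handover (a : ℕ) (x : Fin 3) (T : ℕ) : Set where
      field
        σ          : ℕ
        j y        : Fin 3
        a≤σ        : a ≤ σ
        σ<T        : σ < T
        j≢x        : j ≢ x
        x≢y        : x ≢ y
        j≢y        : j ≢ y
        deep-j     : CopDeep j σ
        forewarned : Forewarned (suc σ) y

    -- σ is the last time before T at which the cop is deep in another leg j; the robber
    -- then flees to the third leg y, which the cop can only reach after visiting x at T.
    handover : ∀ {a x T} → Forewarned a x → a ≤ T → CopDeep x T → Handover a x T
    handover {a} {x} {T} warned a≤T deep-x with warned T a≤T deep-x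
    ... | u′ , a≤u′ , u′<T , elsewhere with latest (deepElsewhere? x) T u′<T elsewhere
    ... | σ , u′≤σ , σ<T , (j , j≢x , deep-j) , after with third x j
    ... | y , y≢x , y≢j = record
      { σ = σ ; j = j ; y = y ; a≤σ = ≤-trans a≤u′ u′≤σ ; σ<T = σ<T ; j≢x = j≢x
      ; x≢y = λ x≡y → y≢x (sym x≡y) ; j≢y = λ j≡y → y≢j (sym j≡y) ; deep-j = deep-j
      ; forewarned = forewarned }
      where
      forewarned : Forewarned (suc σ) y
      forewarned u σ<u deep-y with T ≤? u
      ... | yes T≤u = T , σ<T , ≤∧≢⇒< T≤u T≢u , x , (λ x≡y → y≢x (sym x≡y)) , deep-x
        where
        T≢u : T ≢ u
        T≢u T≡u = y≢x (deep-unique deep-y (subst (CopDeep x) T≡u deep-x))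
      ... | no T≰u = ⊥-elim (after u σ<u (≰⇒> T≰u) (y , y≢x , deep-y))

    escape-by-settling : ∀ {s x i} → CopDeep i s → i ≢ x → (∀ t → s ≤ t → ¬ CopDeep x t) → Escape s x
    escape-by-settling {s} {x} {i} deep-i i≢x clear =
      (λ t → route x (t ∸ s)) , cong (route x) (n∸n≡0 s) , settle (λ _ → i , i≢x , deep-i) clear

    -- The cop stands still from time s + k on.
    escape : ∀ k {s x i} → n ≤ s + k → CopDeep i s → i ≢ x → Forewarned (suc s) x → Escape s x
    escape zero {s} {x} {i} n≤s+0 deep-i i≢x _ = escape-by-settling deep-i i≢x frozen-clear
      where
      n≤s : n ≤ s
      n≤s = subst (n ≤_) (+-identityʳ s) n≤s+0
      frozen-clear : ∀ t → s ≤ t → ¬ CopDeep x t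
      frozen-clear t s≤t deep-x = i≢x (deep-unique deep-i (subst (Deep x) cop-t≡cop-s deep-x))
        where
        cop-t≡cop-s : cop t ≡ cop s
        cop-t≡cop-s = trans (position-frozen p (≤-trans n≤s s≤t)) (sym (position-frozen p n≤s))
    escape (suc k) {s} {x} {i} bound deep-i i≢x warned with first-after (deep? x) s
    ... | inj₁ clear = escape-by-settling deep-i i≢x clear
    ... | inj₂ (T , s≤T , deep-x , before) =
      let r , evades , r-start =
            retreat {B = 0} x≢y (λ _ → i , i≢x , deep-i) (j , j≢x , deep-j) clear onward
      in r , r-start a≤σ , evades
      where
      s<T : s < T
      s<T = ≤∧≢⇒< s≤T (λ s≡T → i≢x (deep-unique deep-i (subst (CopDeep x) (sym s≡T) deep-x)))
      open Handover (handover warned s<T deep-x)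
      clear : ∀ t → s ≤ t → t ≤ σ → ¬ CopDeep x t
      clear t s≤t t≤σ = before t s≤t (≤-<-trans t≤σ σ<T)
      onward : Escape σ y
      onward = escape k (≤-trans bound (≤-trans (≤-reflexive (+-suc s k)) (+-monoˡ-≤ k a≤σ)))
                    deep-j j≢y forewarned

    -- The robber starts at depth L in a leg x other than the one the cop first goes deep into.
    opening : Σ[ r ∈ (ℕ → V) ] EvadesFrom 0 r
    opening with first-after (λ v → any? (λ j → deep? j v)) 0
    ... | inj₁ never =
      _ , settle {x = fzero} (refuge-safeStart 0) (λ t _ deep → never t z≤n (fzero , deep))
    ... | inj₂ (u₀ , _ , (j₀ , deep₀) , before₀) with third j₀ j₀
    ...   | x , x≢j₀ , _ with first-after (deep? x) 0
    ...     | inj₁ clear = _ , settle (refuge-safeStart 0) clear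
    ...     | inj₂ (T , _ , deep-x , before) =
      let r , evades , _ = retreat x≢y (refuge-safeStart 0) (j , j≢x , deep-j) clear onward in r , evades
      where
      warned : Forewarned 0 x
      warned u _ deep-u = u₀ , z≤n , ≤∧≢⇒< u₀≤u u₀≢u , j₀ , (λ j₀≡x → x≢j₀ (sym j₀≡x)) , deep₀
        where
        u₀≤u : u₀ ≤ u
        u₀≤u = ≮⇒≥ (λ u<u₀ → before₀ u z≤n u<u₀ (x , deep-u))
        u₀≢u : u₀ ≢ u
        u₀≢u u₀≡u = x≢j₀ (deep-unique deep-u (subst (CopDeep j₀) u₀≡u deep₀))
      open Handover (handover warned z≤n deep-x)
      clear : ∀ t → 0 ≤ t → t ≤ σ → ¬ CopDeep x t
      clear t _ t≤σ = before t z≤n (≤-<-trans t≤σ σ<T)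
      onward : Escape σ y
      onward = escape n (m≤n+m n σ) deep-j j≢y forewarned

    evasion : ∃[ r ] Evades G ρ p r
    evasion with opening
    ... | r , lazy , safe = trace n r (λ t → lazy t z≤n) , unseen , unseen-after-cop-move
      where
      unseen : ∀ i → ¬ Reach G ρ (pos p i) (r (toℕ i))
      unseen i = subst (λ v → ¬ Reach G ρ v (r (toℕ i))) (position-toℕ p i) (proj₁ (safe (toℕ i) z≤n))
      unseen-after-cop-move : ∀ i → ¬ Reach G ρ (pos p (fsuc i)) (r (toℕ (inject₁ i)))
      unseen-after-cop-move i =
        subst₂ (λ v w → ¬ Reach G ρ v w) (position-toℕ p (fsuc i)) (cong r (sym (toℕ-inject₁ i)))
               (proj₂ (safe (toℕ i) z≤n))

  robberWins : RobberWins G ρ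
  robberWins p = Pursuit.evasion p

-- Triods and clique-triods

ℓ₃≤len3 : ∀ a b c x → (a ⊓ b) ⊓ c ≤ len3 a b c x
ℓ₃≤len3 a b c fzero               = ≤-trans (m⊓n≤m _ c) (m⊓n≤m a b)
ℓ₃≤len3 a b c (fsuc fzero)        = ≤-trans (m⊓n≤m _ c) (m⊓n≤n a b)
ℓ₃≤len3 a b c (fsuc (fsuc fzero)) = m⊓n≤n _ c

legs-long : ∀ {a b c m} → m ≤ (a ⊓ b) ⊓ c → ∀ x → m ≤ len3 a b c x
legs-long {a} {b} {c} ℓ₃-large x = ≤-trans ℓ₃-large (ℓ₃≤len3 a b c x)

2ρ+2≡ : ∀ ρ → 2 * ρ + 2 ≡ suc (ρ + suc ρ)
2ρ+2≡ = solve-∀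

2ρ+1≡ : ∀ ρ → 2 * ρ + 1 ≡ suc (ρ + ρ)
2ρ+1≡ = solve-∀

1+[m+n]≰m+0 : ∀ {ρ m} → ¬ suc (ρ + m) ≤ ρ + 0
1+[m+n]≰m+0 {ρ} h = 1+n≰n (≤-trans h (+-monoʳ-≤ ρ z≤n))

1+[m+n]≤m+1+o⇒n≤o : ∀ ρ m d → suc (ρ + m) ≤ ρ + suc d → m ≤ d
1+[m+n]≤m+1+o⇒n≤o ρ m d h = ≤-pred (+-cancelˡ-≤ ρ (suc m) (suc d) (≤-trans (≤-reflexive (+-suc ρ m)) h))

m+[n∸m⊓n]≡n : ∀ {f m} → f ≤ m → f + (m ∸ (f ⊓ m)) ≡ m
m+[n∸m⊓n]≡n {f} {m} f≤m = trans (cong (λ e → f + (m ∸ e)) (m≤n⇒m⊓n≡m f≤m)) (m+[n∸m]≡n f≤m)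

module TriodLegs {a b c : ℕ} (ρ : ℕ) (long : ∀ x → suc (ρ + suc ρ) ≤ len3 a b c x) where
  private
    G : Graph
    G = Triod a b c
    L′ : ℕ
    L′ = ρ + suc ρ

  route : Fin 3 → ℕ → TV a b c
  route x zero    = origin
  route x (suc f) = leg x (f ⊓ L′) (≤-<-trans (m⊓n≤n f L′) (long x))

  leg-near : ∀ x {d d′} (p : d < len3 a b c x) (q : d′ < len3 a b c x) → Near d d′ →
             LazyAdj G (leg x d p) (leg x d′ q)
  leg-near x p q near with near-cases near
  ... | inj₁ refl        = inj₁ (cong (leg x _) (<-irrelevant p q))
  ... | inj₂ (inj₁ refl) = inj₂ (inj₁ (next p q))
  ... | inj₂ (inj₂ refl) = inj₂ (inj₂ (next q p))

  route-up : ∀ x f → LazyAdj G (route x f) (route x (suc f))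
  route-up x zero    = inj₂ (inj₁ (root _))
  route-up x (suc f) = leg-near x _ _ (near-⊓ (near-suc f) (near-refl L′))

  depth : Fin 3 → TV a b c → ℕ
  depth x origin = 0
  depth x (leg j d _) with j ≟ᶠ x
  ... | yes _ = suc d
  ... | no  _ = 0

  depth-near : ∀ x {u w} → TE u w → Near (depth x u) (depth x w)
  depth-near x (root {i} _) with i ≟ᶠ x
  ... | yes _ = near-suc 0
  ... | no  _ = near-refl 0
  depth-near x (next {i} {j} _ _) with i ≟ᶠ x
  ... | yes _ = near-suc (suc j)
  ... | no  _ = near-refl 0

  depth-route : ∀ x f → suc L′ ≤ f → suc L′ ≤ depth x (route x f)
  depth-route x (suc f) (s≤s L′≤f) with x ≟ᶠ x
  ... | yes _   = s≤s (⊓-glb L′≤f ≤-refl)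
  ... | no  x≢x = ⊥-elim (x≢x refl)

  deep-unique : ∀ {v i j} → suc L′ ≤ ρ + depth i v → suc L′ ≤ ρ + depth j v → i ≡ j
  deep-unique {origin} deep-i _ = ⊥-elim (1+[m+n]≰m+0 deep-i)
  deep-unique {leg k _ _} {i} {j} deep-i deep-j with k ≟ᶠ i | k ≟ᶠ j
  ... | yes refl | yes refl = refl
  ... | no  _    | _        = ⊥-elim (1+[m+n]≰m+0 deep-i)
  ... | yes _    | no _     = ⊥-elim (1+[m+n]≰m+0 deep-j)

  refugeDist : Fin 3 → TV a b c → ℕ
  refugeDist x origin = suc L′
  refugeDist x (leg j d _) with j ≟ᶠ x
  ... | yes _ = suc L′ ∸ suc d
  ... | no  _ = suc d + suc L′

  refugeDist-near : ∀ x {u w} → TE u w → Near (refugeDist x u) (refugeDist x w)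
  refugeDist-near x (root {i} _) with i ≟ᶠ x
  ... | yes _ = near-∸-suc (suc L′) 0
  ... | no  _ = near-suc (suc L′)
  refugeDist-near x (next {i} {j} _ _) with i ≟ᶠ x
  ... | yes _ = near-∸-suc (suc L′) (suc j)
  ... | no  _ = near-suc (suc j + suc L′)

  refugeDist-route : ∀ x f → f < suc L′ → f + refugeDist x (route x f) ≤ suc L′
  refugeDist-route x zero    _           = ≤-refl
  refugeDist-route x (suc f) (s≤s f<L′) with x ≟ᶠ x
  ... | yes _   = ≤-reflexive (cong suc (m+[n∸m⊓n]≡n (<⇒≤ f<L′)))
  ... | no  x≢x = ⊥-elim (x≢x refl)

  refugeDist-deep : ∀ {w i x} → suc L′ ≤ ρ + depth i w → i ≢ x → suc (suc ρ) + suc L′ ≤ refugeDist x w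
  refugeDist-deep {origin} deep _ = ⊥-elim (1+[m+n]≰m+0 deep)
  refugeDist-deep {leg k d _} {i} {x} deep i≢x with k ≟ᶠ i | k ≟ᶠ x
  ... | no  _    | _        = ⊥-elim (1+[m+n]≰m+0 deep)
  ... | yes refl | yes refl = ⊥-elim (i≢x refl)
  ... | yes refl | no  _    = +-monoˡ-≤ (suc L′) (s≤s (1+[m+n]≤m+1+o⇒n≤o ρ (suc ρ) d deep))

  triodLegs : ThreeLegs G ρ
  triodLegs = record
    { Adj-sym              = swap
    ; L                    = suc L′
    ; route                = route
    ; route-up             = route-up
    ; route-switch         = λ _ → inj₁ refl
    ; depth                = depth
    ; depth-lipschitz      = λ x → near-edges⇒lipschitz {E = TE} {φ = depth x} (depth-near x)
    ; depth-route          = depth-route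
    ; deep-unique          = λ {v} → deep-unique {v}
    ; refugeDist           = refugeDist
    ; refugeDist-lipschitz = λ x → near-edges⇒lipschitz {E = TE} {φ = refugeDist x} (refugeDist-near x)
    ; refugeDist-route     = refugeDist-route
    ; refugeDist-deep      = λ {w} → refugeDist-deep {w}
    }

module CliqueTriodLegs {k a b c : ℕ} {att : Fin 3 → Fin k} (att-injective : Injective _≡_ _≡_ att)
                       (ρ : ℕ) (long : ∀ x → suc (ρ + ρ) ≤ len3 a b c x) where
  private
    G : Graph
    G = CliqueTriod k a b c att
    L′ : ℕ
    L′ = ρ + ρ

  route : Fin 3 → ℕ → CV k a b c
  route x zero    = cl (att x)
  route x (suc f) = pth x (f ⊓ L′) (≤-<-trans (m⊓n≤n f L′) (long x))

  path-near : ∀ x {d d′} (p : d < len3 a b c x) (q : d′ < len3 a b c x) → Near d d′ →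
              LazyAdj G (pth x d p) (pth x d′ q)
  path-near x p q near with near-cases near
  ... | inj₁ refl        = inj₁ (cong (pth x _) (<-irrelevant p q))
  ... | inj₂ (inj₁ refl) = inj₂ (inj₁ (next p q))
  ... | inj₂ (inj₂ refl) = inj₂ (inj₂ (next q p))

  route-up : ∀ x f → LazyAdj G (route x f) (route x (suc f))
  route-up x zero    = inj₂ (inj₁ (root _))
  route-up x (suc f) = path-near x _ _ (near-⊓ (near-suc f) (near-refl L′))

  route-switch : ∀ {x y} → x ≢ y → LazyAdj G (route x 0) (route y 0)
  route-switch x≢y = inj₂ (inj₁ (clique (λ att-x≡att-y → x≢y (att-injective att-x≡att-y))))

  depth : Fin 3 → CV k a b c → ℕ
  depth x (cl _) = 0
  depth x (pth j d _) with j ≟ᶠ x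
  ... | yes _ = suc d
  ... | no  _ = 0

  depth-near : ∀ x {u w} → CE att u w → Near (depth x u) (depth x w)
  depth-near x (clique _) = near-refl 0
  depth-near x (root {i} _) with i ≟ᶠ x
  ... | yes _ = near-suc 0
  ... | no  _ = near-refl 0
  depth-near x (next {i} {j} _ _) with i ≟ᶠ x
  ... | yes _ = near-suc (suc j)
  ... | no  _ = near-refl 0

  depth-route : ∀ x f → suc L′ ≤ f → suc L′ ≤ depth x (route x f)
  depth-route x (suc f) (s≤s L′≤f) with x ≟ᶠ x
  ... | yes _   = s≤s (⊓-glb L′≤f ≤-refl)
  ... | no  x≢x = ⊥-elim (x≢x refl)

  deep-unique : ∀ {v i j} → suc L′ ≤ ρ + depth i v → suc L′ ≤ ρ + depth j v → i ≡ j
  deep-unique {cl _} deep-i _ = ⊥-elim (1+[m+n]≰m+0 deep-i)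
  deep-unique {pth k _ _} {i} {j} deep-i deep-j with k ≟ᶠ i | k ≟ᶠ j
  ... | yes refl | yes refl = refl
  ... | no  _    | _        = ⊥-elim (1+[m+n]≰m+0 deep-i)
  ... | yes _    | no _     = ⊥-elim (1+[m+n]≰m+0 deep-j)

  -- Leaving the clique through a vertex other than att x costs one extra step.
  refugeDist : Fin 3 → CV k a b c → ℕ
  refugeDist x (cl u) with u ≟ᶠ att x
  ... | yes _ = suc L′
  ... | no  _ = suc (suc L′)
  refugeDist x (pth j d _) with j ≟ᶠ x
  ... | yes _ = suc L′ ∸ suc d
  ... | no  _ = suc (suc d) + suc L′

  refugeDist-near : ∀ x {u w} → CE att u w → Near (refugeDist x u) (refugeDist x w)
  refugeDist-near x (clique {u} {v} _) with u ≟ᶠ att x | v ≟ᶠ att x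
  ... | yes _ | yes _ = near-refl (suc L′)
  ... | yes _ | no  _ = near-suc (suc L′)
  ... | no  _ | yes _ = near-sym (near-suc (suc L′))
  ... | no  _ | no  _ = near-refl (suc (suc L′))
  refugeDist-near x (root {i} _) with att i ≟ᶠ att x | i ≟ᶠ x
  ... | yes _           | yes _   = near-∸-suc (suc L′) 0
  ... | yes att-i≡att-x | no  i≢x = ⊥-elim (i≢x (att-injective att-i≡att-x))
  ... | no  att-i≢att-x | yes i≡x = ⊥-elim (att-i≢att-x (cong att i≡x))
  ... | no  _           | no  _   = near-suc (suc (suc L′))
  refugeDist-near x (next {i} {j} _ _) with i ≟ᶠ x
  ... | yes _ = near-∸-suc (suc L′) (suc j)
  ... | no  _ = near-suc (suc (suc j) + suc L′)

  refugeDist-route : ∀ x f → f < suc L′ → f + refugeDist x (route x f) ≤ suc L′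
  refugeDist-route x zero _ with att x ≟ᶠ att x
  ... | yes _           = ≤-refl
  ... | no  att-x≢att-x = ⊥-elim (att-x≢att-x refl)
  refugeDist-route x (suc f) (s≤s f<L′) with x ≟ᶠ x
  ... | yes _   = ≤-reflexive (cong suc (m+[n∸m⊓n]≡n (<⇒≤ f<L′)))
  ... | no  x≢x = ⊥-elim (x≢x refl)

  refugeDist-deep : ∀ {w i x} → suc L′ ≤ ρ + depth i w → i ≢ x → suc (suc ρ) + suc L′ ≤ refugeDist x w
  refugeDist-deep {cl _} deep _ = ⊥-elim (1+[m+n]≰m+0 deep)
  refugeDist-deep {pth k d _} {i} {x} deep i≢x with k ≟ᶠ i | k ≟ᶠ x
  ... | no  _    | _        = ⊥-elim (1+[m+n]≰m+0 deep)
  ... | yes refl | yes refl = ⊥-elim (i≢x refl)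
  ... | yes refl | no  _    = +-monoˡ-≤ (suc L′) (s≤s (s≤s (1+[m+n]≤m+1+o⇒n≤o ρ ρ d deep)))

  cliqueTriodLegs : ThreeLegs G ρ
  cliqueTriodLegs = record
    { Adj-sym              = swap
    ; L                    = suc L′
    ; route                = route
    ; route-up             = route-up
    ; route-switch         = route-switch
    ; depth                = depth
    ; depth-lipschitz      = λ x → near-edges⇒lipschitz {E = CE att} {φ = depth x} (depth-near x)
    ; depth-route          = depth-route
    ; deep-unique          = λ {v} → deep-unique {v}
    ; refugeDist           = refugeDist
    ; refugeDist-lipschitz = λ x → near-edges⇒lipschitz {E = CE att} {φ = refugeDist x} (refugeDist-near x)
    ; refugeDist-route     = refugeDist-route
    ; refugeDist-deep      = λ {w} → refugeDist-deep {w}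
    }

lemma3 : (∀ (ρ a b c : ℕ) → 2 * ρ + 2 ≤ ℓ₃-triod a b c →
            RobberWins (Triod a b c) ρ)
         × (∀ (ρ k a b c : ℕ) (att : Fin 3 → Fin k) → 3 ≤ k →
            Injective _≡_ _≡_ att → 2 * ρ + 1 ≤ ℓ₃-clique a b c →
            RobberWins (CliqueTriod k a b c att) ρ)
lemma3 =
    (λ ρ a b c ℓ₃-large → RobberEscape.robberWins (TriodLegs.triodLegs ρ
       (legs-long (subst (_≤ ℓ₃-triod a b c) (2ρ+2≡ ρ) ℓ₃-large))))
  , (λ ρ k a b c att _ att-injective ℓ₃-large → RobberEscape.robberWins (CliqueTriodLegs.cliqueTriodLegs att-injective ρ
       (legs-long (subst (_≤ ℓ₃-clique a b c) (2ρ+1≡ ρ) ℓ₃-large))))
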